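{- Let $G$ be a connected graph with radius $rad(G)$. Then $vcfc(G)\le rad(G)+1$.
   Context: The eccentricity of a vertex $v$ is the maximum distance from $v$ to the other vertices; the radius $rad(G)$ is the minimum eccentricity over all vertices. Vertex-colorings are arbitrary, not necessarily proper. A path in a vertex-colored graph is called conflict-free if there is a color used on exactly one of its vertices. A vertex-colored graph is conflict-free vertex-connected if any two vertices of the graph are connected by a conflict-free path. For a connected graph $G$, the conflict-free vertex-connection number $vcfc(G)$ is the smallest number of colors needed in a vertex-coloring of $G$ that makes $G$ conflict-free vertex-connected. -}

module Defs where

open import Data.Nat using (ℕ; zero; suc; _≤_)
open import Data.Fin using (Fin; _≟_)
open import Data.List using (List; []; _∷_; filter; length)
open import Data.List.Relation.Unary.Unique.Propositional using (Unique)
open import Data.Product using (Σ; ∃; ∃-syntax; _×_; _,_)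
open import Relation.Binary.PropositionalEquality using (_≡_)
open import Relation.Nullary using (¬_)

record Graph (n : ℕ) : Set₁ where
  field
    Adj     : Fin n → Fin n → Set
    sym     : ∀ {u v} → Adj u v → Adj v u
    irrefl  : ∀ {u} → ¬ Adj u u
open Graph public

module _ {n : ℕ} (G : Graph n) where

  data Walk : Fin n → Fin n → Set where
    [_] : (u : Fin n) → Walk u u
    _∷⟨_⟩_ : (u : Fin n) {v w : Fin n} → Adj G u v → Walk v w → Walk u w

  vertices : ∀ {u v} → Walk u v → List (Fin n)
  vertices [ u ] = u ∷ []
  vertices (u ∷⟨ _ ⟩ p) = u ∷ vertices p

  len : ∀ {u v} → Walk u v → ℕ
  len [ u ] = 0
  len (u ∷⟨ _ ⟩ p) = suc (len p)

  Path : Fin n → Fin n → Set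
  Path u v = Σ (Walk u v) λ p → Unique (vertices p)

  Connected : Set
  Connected = ∀ u v → Path u v

  IsDist : Fin n → Fin n → ℕ → Set
  IsDist u v d = (Σ (Path u v) λ p → len (Data.Product.proj₁ p) ≡ d)
               × (∀ (p : Path u v) → d ≤ len (Data.Product.proj₁ p))

  IsEcc : Fin n → ℕ → Set
  IsEcc v e = (∀ w d → IsDist v w d → d ≤ e) × (∃[ w ] IsDist v w e)

  IsRadius : ℕ → Set
  IsRadius r = (∃[ v ] IsEcc v r) × (∀ v e → IsEcc v e → r ≤ e)

  Coloring : ℕ → Set
  Coloring k = Fin n → Fin k

  ConflictFree : ∀ {k u v} → Coloring k → Walk u v → Set
  ConflictFree {k} c p = ∃[ a ] length (filter (λ x → c x ≟ a) (vertices p)) ≡ 1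

  CFConnected : ∀ {k} → Coloring k → Set
  CFConnected c = ∀ u v → Σ (Path u v) λ p → ConflictFree c (Data.Product.proj₁ p)

  IsVcfc : ℕ → Set
  IsVcfc k = (Σ (Coloring k) CFConnected)
           × (∀ j → (c : Coloring j) → CFConnected c → k ≤ j)

-- Colour every vertex by its distance to a centre v; the colours are then 0, …, rad(G).
-- For any two vertices x and y, repeatedly step the endpoint of larger level one edge
-- towards v until the two ends meet. The result is a path whose levels strictly
-- decrease and then strictly increase, so its lowest level, hence its colour, is
-- attained exactly once.
--
-- The adjacency relation is not decidable, so distances cannot be computed; they exist
-- only under a double negation, which is harmless because the conclusion k ≤ rad(G) + 1
-- is decidable.
module Submission where

open import Defs hiding (sym)
open import Data.Nat using (ℕ; zero; suc; _≤_; _<_; _+_; s≤s; _≤?_)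
open import Data.Nat.Induction using (<-rec)
open import Data.Nat.Properties
  using (≤-refl; ≤-trans; module ≤-Reasoning; <-≤-trans; ≤-<-trans; <⇒≤; ≰⇒>; ≮⇒≥; <-irrefl; <-asym;
         <⇒≱; <-trans; n≤0⇒n≡0; n≢0⇒n>0; +-identityʳ; +-monoˡ-<; +-monoʳ-<)
open import Data.Fin using (Fin; _≟_; toℕ; fromℕ<) renaming (zero to fzero; suc to fsuc)
open import Data.Fin.Properties using (toℕ-fromℕ<)
open import Data.List using (List; []; _∷_; _++_; filter; length)
open import Data.List.Properties using (filter-accept; filter-reject; filter-++; length-++)
open import Data.List.Relation.Unary.All using (All; []; _∷_)
import Data.List.Relation.Unary.All as All
import Data.List.Relation.Unary.All.Properties as All
open import Data.List.Relation.Unary.AllPairs using ([]; _∷_)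
open import Data.List.Relation.Unary.Any using (here)
open import Data.List.Relation.Unary.Unique.Propositional using (Unique)
import Data.List.Relation.Unary.Unique.Propositional.Properties as Unique
open import Data.Product using (Σ; ∃; _×_; _,_; proj₁; proj₂)
open import Data.Sum using (_⊎_; inj₁; inj₂)
open import Effect.Monad using (RawMonad)
open import Function using (_$_)
open import Level using (0ℓ)
open import Relation.Nullary using (¬_; Dec; yes; no)
open import Relation.Nullary.Decidable using (decidable-stable)
open import Relation.Nullary.Negation using (¬¬-Monad)
open import Relation.Binary.PropositionalEquality
  using (_≡_; _≢_; refl; sym; trans; cong; subst; module ≡-Reasoning)

open RawMonad (¬¬-Monad {a = 0ℓ}) using (_>>=_; return)

¬¬-minimal : ∀ {A : Set} (f : A → ℕ) → A → ¬ ¬ (Σ A λ a → ∀ b → f a ≤ f b)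
¬¬-minimal {A} f a noMinimum = <-rec (λ m → ∀ b → f b ≢ m) absent (f a) a refl
  where
  absent : ∀ m → (∀ {j} → j < m → ∀ b → f b ≢ j) → ∀ b → f b ≢ m
  absent m below b refl = noMinimum (b , λ b′ → ≮⇒≥ λ fb′<fb → below fb′<fb b′ refl)

¬¬-pull-Fin : ∀ {n} {P : Fin n → Set} → (∀ i → ¬ ¬ P i) → ¬ ¬ (∀ i → P i)
¬¬-pull-Fin {zero}  _  = return λ ()
¬¬-pull-Fin {suc n} ¬¬P = do
  p₀ ← ¬¬P fzero
  ps ← ¬¬-pull-Fin (λ i → ¬¬P (fsuc i))
  return λ { fzero → p₀ ; (fsuc i) → ps i }

Unique-∷ʳ : ∀ {A : Set} {xs : List A} {y} → Unique xs → All (_≢ y) xs → Unique (xs ++ y ∷ [])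
Unique-∷ʳ uniq ≢y =
  Unique.++⁺ uniq ([] ∷ []) λ { (x∈xs , here refl) → All.lookup ≢y x∈xs refl }

module Walks {n} (G : Graph n) where

  _∷ʳ⟨_⟩ : ∀ {u w x} → Walk G u w → Adj G w x → Walk G u x
  [ u ]          ∷ʳ⟨ a ⟩ = u ∷⟨ a ⟩ [ _ ]
  (u ∷⟨ b ⟩ p) ∷ʳ⟨ a ⟩ = u ∷⟨ b ⟩ (p ∷ʳ⟨ a ⟩)

  vertices-∷ʳ : ∀ {u w x} (p : Walk G u w) (a : Adj G w x) →
                vertices G (p ∷ʳ⟨ a ⟩) ≡ vertices G p ++ x ∷ []
  vertices-∷ʳ [ u ]        a = refl
  vertices-∷ʳ (u ∷⟨ b ⟩ p) a = cong (u ∷_) (vertices-∷ʳ p a)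

  len-∷ʳ : ∀ {u w x} (p : Walk G u w) (a : Adj G w x) → len G (p ∷ʳ⟨ a ⟩) ≡ suc (len G p)
  len-∷ʳ [ u ]        a = refl
  len-∷ʳ (u ∷⟨ b ⟩ p) a = cong suc (len-∷ʳ p a)

  reverse : ∀ {u w} → Walk G u w → Walk G w u
  reverse [ u ]        = [ u ]
  reverse (u ∷⟨ a ⟩ p) = reverse p ∷ʳ⟨ Graph.sym G a ⟩

  len-reverse : ∀ {u w} (p : Walk G u w) → len G (reverse p) ≡ len G p
  len-reverse [ u ]        = refl
  len-reverse (u ∷⟨ a ⟩ p) = trans (len-∷ʳ (reverse p) (Graph.sym G a)) (cong suc (len-reverse p))

  All-source : ∀ {P : Fin n → Set} {u w} (p : Walk G u w) → All P (vertices G p) → P u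
  All-source [ u ]        (Pu ∷ _) = Pu
  All-source (u ∷⟨ a ⟩ p) (Pu ∷ _) = Pu

  All-target : ∀ {P : Fin n → Set} {u w} (p : Walk G u w) → All P (vertices G p) → P w
  All-target [ u ]        (Pu ∷ _)  = Pu
  All-target (u ∷⟨ a ⟩ p) (_ ∷ Pps) = All-target p Pps

  ShortestWalk : Fin n → Fin n → Set
  ShortestWalk u w = Σ (Walk G u w) λ p → ∀ (q : Walk G u w) → len G p ≤ len G q

  ¬¬-shortestWalk-≤-ecc : ∀ {v e} → Connected G → IsEcc G v e →
                          ∀ w → ¬ ¬ (Σ (ShortestWalk w v) λ s → len G (proj₁ s) ≤ e)
  ¬¬-shortestWalk-≤-ecc {v} {e} conn ecc w = do
    (p , p-shortest) ← ¬¬-minimal (λ (p : Path G v w) → len G (proj₁ p)) (conn v w)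
    let q = reverse (proj₁ p)
    (s , s-shortest) ← ¬¬-minimal (λ (q : Walk G w v) → len G q) q
    let open ≤-Reasoning
    return ((s , s-shortest) , (begin
      len G s          ≤⟨ s-shortest q ⟩
      len G q          ≡⟨ len-reverse (proj₁ p) ⟩
      len G (proj₁ p)  ≤⟨ proj₁ ecc w _ ((p , refl) , p-shortest) ⟩
      e                ∎))

module LevelColouring {n} (G : Graph n) (ℓ : Fin n → ℕ)
  (descends : ∀ {w} → 0 < ℓ w → ∃ λ w′ → Adj G w w′ × ℓ w′ < ℓ w)
  (ground-unique : ∀ {x y} → ℓ x ≡ 0 → ℓ y ≡ 0 → x ≡ y)
  {k} (c : Coloring G k) (c⇒ℓ : ∀ {x y} → c x ≡ c y → ℓ x ≡ ℓ y) where

  open Walks G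

  occurrences : Fin k → List (Fin n) → ℕ
  occurrences a xs = length (filter (λ x → c x ≟ a) xs)

  occurrences-∷-other : ∀ {a x} xs → c x ≢ a → occurrences a (x ∷ xs) ≡ occurrences a xs
  occurrences-∷-other _ cx≢a = cong length (filter-reject (λ x → c x ≟ _) cx≢a)

  occurrences-∷ʳ-other : ∀ {a x} xs → c x ≢ a → occurrences a (xs ++ x ∷ []) ≡ occurrences a xs
  occurrences-∷ʳ-other {a} {x} xs cx≢a = begin
    length (filter P? (xs ++ x ∷ []))           ≡⟨ cong length (filter-++ P? xs (x ∷ [])) ⟩
    length (filter P? xs ++ filter P? (x ∷ [])) ≡⟨ length-++ (filter P? xs) ⟩
    occurrences a xs + occurrences a (x ∷ [])   ≡⟨ cong (occurrences a xs +_)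
                                                        (occurrences-∷-other [] cx≢a) ⟩
    occurrences a xs + 0                        ≡⟨ +-identityʳ _ ⟩
    occurrences a xs                            ∎
    where
    open ≡-Reasoning
    P? : (u : Fin n) → Dec (c u ≡ a)
    P? u = c u ≟ a

  lower-neighbour : ∀ {x y} → x ≢ y → ℓ y ≤ ℓ x → ∃ λ x′ → Adj G x x′ × ℓ x′ < ℓ x
  lower-neighbour {x} {y} x≢y ℓy≤ℓx = descends $ n≢0⇒n>0 λ ℓx≡0 →
    x≢y (ground-unique ℓx≡0 (n≤0⇒n≡0 (subst (ℓ y ≤_) ℓx≡0 ℓy≤ℓx)))

  -- The invariant that keeps the walk built below a path.
  Under : Fin n → Fin n → Fin n → Set
  Under x y u = u ≡ x ⊎ u ≡ y ⊎ ℓ u < ℓ x ⊎ ℓ u < ℓ y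

  record IsValley (x y : Fin n) (vs : List (Fin n)) : Set where
    constructor valley
    field
      unique       : Unique vs
      under        : All (Under x y) vs
      bottom       : Fin n
      bottom-once  : occurrences (c bottom) vs ≡ 1
      bottom-least : All (λ u → ℓ bottom ≤ ℓ u) vs

  Valley : Fin n → Fin n → Set
  Valley x y = Σ (Walk G x y) λ p → IsValley x y (vertices G p)

  valley-refl : ∀ x → Valley x x
  valley-refl x = [ x ] , valley ([] ∷ []) (inj₁ refl ∷ []) x
    (cong length (filter-accept (λ u → c u ≟ c x) refl)) (≤-refl ∷ [])

  valley-∷ : ∀ {x x′ y} → x ≢ y → ℓ y ≤ ℓ x → Adj G x x′ → ℓ x′ < ℓ x →
             Valley x′ y → Valley x y
  valley-∷ {x} {x′} {y} x≢y ℓy≤ℓx x~x′ ℓx′<ℓx (p , valley uniq under z once least) =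
    x ∷⟨ x~x′ ⟩ p ,
    valley (All.map x≢ under ∷ uniq) (inj₁ refl ∷ All.map widen under) z
           (trans (occurrences-∷-other (vertices G p) x≢z) once)
           (<⇒≤ ℓz<ℓx ∷ least)
    where
    ℓz<ℓx : ℓ z < ℓ x
    ℓz<ℓx = ≤-<-trans (All-source p least) ℓx′<ℓx
    x≢z : c x ≢ c z
    x≢z cx≡cz = <-irrefl (sym (c⇒ℓ cx≡cz)) ℓz<ℓx
    x≢ : ∀ {u} → Under x′ y u → x ≢ u
    x≢ (inj₁ refl)                 refl = <-irrefl refl ℓx′<ℓx
    x≢ (inj₂ (inj₁ refl))          x≡y  = x≢y x≡y
    x≢ (inj₂ (inj₂ (inj₁ ℓx<ℓx′))) refl = <-asym ℓx<ℓx′ ℓx′<ℓx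
    x≢ (inj₂ (inj₂ (inj₂ ℓx<ℓy)))  refl = <⇒≱ ℓx<ℓy ℓy≤ℓx
    widen : ∀ {u} → Under x′ y u → Under x y u
    widen (inj₁ refl)                 = inj₂ (inj₂ (inj₁ ℓx′<ℓx))
    widen (inj₂ (inj₁ u≡y))           = inj₂ (inj₁ u≡y)
    widen (inj₂ (inj₂ (inj₁ ℓu<ℓx′))) = inj₂ (inj₂ (inj₁ (<-trans ℓu<ℓx′ ℓx′<ℓx)))
    widen (inj₂ (inj₂ (inj₂ ℓu<ℓy)))  = inj₂ (inj₂ (inj₂ ℓu<ℓy))

  valley-∷ʳ : ∀ {x y y′} → x ≢ y → ℓ x < ℓ y → Adj G y y′ → ℓ y′ < ℓ y →
              Valley x y′ → Valley x y
  valley-∷ʳ {x} {y} {y′} x≢y ℓx<ℓy y~y′ ℓy′<ℓy (p , valley uniq under z once least) =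
    p ∷ʳ⟨ y′~y ⟩ ,
    subst (IsValley x y) (sym (vertices-∷ʳ p y′~y))
      (valley (Unique-∷ʳ uniq (All.map ≢y under))
              (All.++⁺ (All.map widen under) (inj₂ (inj₁ refl) ∷ [])) z
              (trans (occurrences-∷ʳ-other (vertices G p) y≢z) once)
              (All.++⁺ least (<⇒≤ ℓz<ℓy ∷ [])))
    where
    y′~y : Adj G y′ y
    y′~y = Graph.sym G y~y′
    ℓz<ℓy : ℓ z < ℓ y
    ℓz<ℓy = ≤-<-trans (All-target p least) ℓy′<ℓy
    y≢z : c y ≢ c z
    y≢z cy≡cz = <-irrefl (sym (c⇒ℓ cy≡cz)) ℓz<ℓy
    ≢y : ∀ {u} → Under x y′ u → u ≢ y
    ≢y (inj₁ refl)                 x≡y  = x≢y x≡y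
    ≢y (inj₂ (inj₁ refl))          refl = <-irrefl refl ℓy′<ℓy
    ≢y (inj₂ (inj₂ (inj₁ ℓy<ℓx)))  refl = <-asym ℓy<ℓx ℓx<ℓy
    ≢y (inj₂ (inj₂ (inj₂ ℓy<ℓy′))) refl = <-asym ℓy<ℓy′ ℓy′<ℓy
    widen : ∀ {u} → Under x y′ u → Under x y u
    widen (inj₁ u≡x)                  = inj₁ u≡x
    widen (inj₂ (inj₁ refl))          = inj₂ (inj₂ (inj₂ ℓy′<ℓy))
    widen (inj₂ (inj₂ (inj₁ ℓu<ℓx)))  = inj₂ (inj₂ (inj₁ ℓu<ℓx))
    widen (inj₂ (inj₂ (inj₂ ℓu<ℓy′))) = inj₂ (inj₂ (inj₂ (<-trans ℓu<ℓy′ ℓy′<ℓy)))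

  valley-bounded : ∀ N x y → ℓ x + ℓ y < N → Valley x y
  valley-bounded (suc N) x y (s≤s ℓx+ℓy≤N) with x ≟ y | ℓ y ≤? ℓ x
  ... | yes refl | _ = valley-refl x
  ... | no x≢y | yes ℓy≤ℓx =
    let (x′ , x~x′ , ℓx′<ℓx) = lower-neighbour x≢y ℓy≤ℓx
    in valley-∷ x≢y ℓy≤ℓx x~x′ ℓx′<ℓx
         (valley-bounded N x′ y (<-≤-trans (+-monoˡ-< (ℓ y) ℓx′<ℓx) ℓx+ℓy≤N))
  ... | no x≢y | no ℓy≰ℓx =
    let ℓx<ℓy = ≰⇒> ℓy≰ℓx
        (y′ , y~y′ , ℓy′<ℓy) = lower-neighbour (λ y≡x → x≢y (sym y≡x)) (<⇒≤ ℓx<ℓy)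
    in valley-∷ʳ x≢y ℓx<ℓy y~y′ ℓy′<ℓy
         (valley-bounded N x y′ (<-≤-trans (+-monoʳ-< (ℓ x) ℓy′<ℓy) ℓx+ℓy≤N))

  cfConnected : CFConnected G c
  cfConnected x y =
    let (p , valley uniq _ z once _) = valley-bounded (suc (ℓ x + ℓ y)) x y ≤-refl
    in (p , uniq) , c z , once

module ShortestWalkLevels {n} (G : Graph n) {v r}
  (sw : ∀ w → Σ (Walks.ShortestWalk G w v) λ s → len G (proj₁ s) ≤ r) where

  open Walks G

  level : Fin n → ℕ
  level w = len G (proj₁ (proj₁ (sw w)))

  descends : ∀ {w} → 0 < level w → ∃ λ w′ → Adj G w w′ × level w′ < level w
  descends {w} = first-step (proj₁ (sw w))
    where
    first-step : (s : ShortestWalk w v) → 0 < len G (proj₁ s) →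
                 ∃ λ w′ → Adj G w w′ × level w′ < len G (proj₁ s)
    first-step ([ _ ] , _)           ()
    first-step (_ ∷⟨ w~w′ ⟩ q , _) _ = _ , w~w′ , s≤s (proj₂ (proj₁ (sw _)) q)

  level-zero : ∀ {w} → level w ≡ 0 → w ≡ v
  level-zero {w} = at-root (proj₁ (proj₁ (sw w)))
    where
    at-root : ∀ {u} (q : Walk G u v) → len G q ≡ 0 → u ≡ v
    at-root [ _ ]         _  = refl
    at-root (_ ∷⟨ _ ⟩ _) ()

  ground-unique : ∀ {x y} → level x ≡ 0 → level y ≡ 0 → x ≡ y
  ground-unique ℓx≡0 ℓy≡0 = trans (level-zero ℓx≡0) (sym (level-zero ℓy≡0))

  colouring : Coloring G (suc r)
  colouring w = fromℕ< (s≤s (proj₂ (sw w)))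

  colouring⇒level : ∀ {x y} → colouring x ≡ colouring y → level x ≡ level y
  colouring⇒level {x} {y} cx≡cy = begin
    level x           ≡⟨ sym (toℕ-fromℕ< (s≤s (proj₂ (sw x)))) ⟩
    toℕ (colouring x) ≡⟨ cong toℕ cx≡cy ⟩
    toℕ (colouring y) ≡⟨ toℕ-fromℕ< (s≤s (proj₂ (sw y))) ⟩
    level y           ∎
    where open ≡-Reasoning

  cfConnected : CFConnected G colouring
  cfConnected =
    LevelColouring.cfConnected G level descends ground-unique colouring colouring⇒level

vcfc≤ecc+1 : ∀ {n} (G : Graph n) {v e k} → Connected G → IsEcc G v e → IsVcfc G k → k ≤ suc e
vcfc≤ecc+1 G {e = e} {k} conn ecc (_ , least) = decidable-stable (k ≤? suc e) $ do
  sw ← ¬¬-pull-Fin (Walks.¬¬-shortestWalk-≤-ecc G conn ecc)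
  let open ShortestWalkLevels G sw
  return (least (suc e) colouring cfConnected)

corollary3 : ∀ {n} (G : Graph n) (r k : ℕ) → Connected G → IsRadius G r → IsVcfc G k → k ≤ suc r
corollary3 G r k conn ((v , ecc) , _) vcfc = vcfc≤ecc+1 G conn ecc vcfc
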